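{- Let $k\ge1$, $n\ge1$, $m=kn+1$, $N=m+n-1$, $D\in\mathcal D_{m,n}$, $T=T(D)$, and let $f:\{1,\dots,N+1\}\to\{1,\dots,N+1\}$ be the walk function of $T$. Then in the directed graph on $\{1,\dots,m+n\}$ with edges $x\to f(x)$, every vertex has out-degree $1$ and in-degree $1$ (i.e. $f$ is a bijection).
   Context: $\mathcal D_{m,n}$ (coprime $m,n$) is the set of lattice paths from $(0,0)$ to $(m,n)$ with unit North and East steps staying weakly above the segment from $(0,0)$ to $(m,n)$; $\mathrm{SW}(D)$ is its step word ($S$ for North, $W$ for East). $T(D)$ is the array with $k+1$ rows and $n$ columns obtained by the filling algorithm: place $1$ at the top of column 1; for $i=2,\dots,m+n-1$, if the $i$-th letter of $\mathrm{SW}(D)$ is $S$ place $i$ at the top of the leftmost empty column, and if $W$ place $i$ immediately below the smallest active entry (lowest in its column and not in row $k+1$). $T_{i,j}$ is the entry in row $i$, column $j$. Walk function: with $b_j=T_{k+1,j}$ and bold set $B=\{b_1+1,\dots,b_n+1\}$, set $f(T_{1,j})=b_j+1$; for $i\ge2$, with $y=T_{i-1,j}$, $f(T_{i,j})=y$ if $y\notin B$ and $f(T_{i,j})=\max\{z<y:z\notin B\}$ if $y\in B$; and $f(N+1)=\max\{z\le N:z\notin B\}$. -}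

module Defs where

open import Data.Nat using (ℕ; zero; suc; _+_; _*_; _∸_; _≤_; _<ᵇ_; _≡ᵇ_)
open import Data.Bool using (Bool; true; false; if_then_else_)
open import Data.List using (List; []; _∷_; _++_; map; take; drop; replicate; length)
open import Data.Bool.ListAction using (any; all)
open import Data.Maybe using (Maybe; just; nothing; fromMaybe)
open import Data.Product using (Σ; _×_)
open import Relation.Binary.PropositionalEquality using (_≡_)

data Step : Set where
  north east : Step

countNorth countEast : List Step → ℕ
countNorth []           = 0
countNorth (north ∷ s)  = suc (countNorth s)
countNorth (east ∷ s)   = countNorth s
countEast []            = 0
countEast (east ∷ s)    = suc (countEast s)
countEast (north ∷ s)   = countEast s

-- D ∈ 𝒟_{m,n}: path from (0,0) to (m,n) (m east steps, n north steps)
-- whose every lattice point (a,b) lies weakly above the segment from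
-- (0,0) to (m,n), i.e. a·n ≤ b·m.  The lattice points of the path are
-- the endpoints of its prefixes.
InD : ℕ → ℕ → List Step → Set
InD m n D =
  countEast D ≡ m × countNorth D ≡ n ×
  ((i : ℕ) → countEast (take i D) * n ≤ countNorth (take i D) * m)

data Letter : Set where
  S W : Letter

SW : List Step → List Letter
SW = map λ { north → S ; east → W }

mOf : ℕ → ℕ → ℕ
mOf k n = k * n + 1

NOf : ℕ → ℕ → ℕ
NOf k n = mOf k n + n ∸ 1

-- Arrays: an array is stored as its list of columns, each column
-- listed from top (row 1) to bottom.

Array : Set
Array = List (List ℕ)

lastM : List ℕ → Maybe ℕ
lastM []           = nothing
lastM (x ∷ [])     = just x
lastM (x ∷ y ∷ xs) = lastM (y ∷ xs)

minM : List ℕ → Maybe ℕ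
minM []       = nothing
minM (x ∷ xs) with minM xs
... | nothing = just x
... | just y  = just (if x <ᵇ y then x else y)

-- the active entry of a column (of an array with k+1 rows): its lowest
-- entry, provided the column is nonempty and that entry is not in row k+1
activeOf : ℕ → List ℕ → List ℕ
activeOf k c with length c <ᵇ suc k | lastM c
... | true  | just x = x ∷ []
... | _     | _      = []

actives : ℕ → Array → List ℕ
actives k []       = []
actives k (c ∷ cs) = activeOf k c ++ actives k cs

putTop : ℕ → Array → Maybe Array
putTop i []             = nothing
putTop i ([] ∷ cs)      = just ((i ∷ []) ∷ cs)
putTop i ((x ∷ c) ∷ cs) with putTop i cs
... | nothing  = nothing
... | just cs' = just ((x ∷ c) ∷ cs')

putBelow : ℕ → ℕ → ℕ → Array → Array
putBelow k v i [] = []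
putBelow k v i (c ∷ cs) with activeOf k c
... | x ∷ [] = (if x ≡ᵇ v then c ++ (i ∷ []) else c) ∷ putBelow k v i cs
... | _      = c ∷ putBelow k v i cs

fillStep : ℕ → ℕ → Letter → Array → Maybe Array
fillStep k i S T = putTop i T
fillStep k i W T with minM (actives k T)
... | nothing = nothing
... | just v  = just (putBelow k v i T)

fillLoop : ℕ → ℕ → List Letter → Array → Maybe Array
fillLoop k i []       T = just T
fillLoop k i (l ∷ ls) T with fillStep k i l T
... | nothing = nothing
... | just T' = fillLoop k (suc i) ls T'

-- T(D) for a step word w: 1 at the top of column 1, then the letters
-- i = 2, …, N of w.  Returns 'just T' iff every step is possible and
-- the result is a full array with k+1 rows and n columns.
fill : ℕ → ℕ → List Letter → Maybe Array
fill k n w with fillLoop k 2 (drop 1 (take (NOf k n) w))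
                         ((1 ∷ []) ∷ replicate (n ∸ 1) [])
... | nothing = nothing
... | just T  = if all (λ c → length c ≡ᵇ suc k) T ∧' (length T ≡ᵇ n)
                then just T else nothing
  where
  _∧'_ : Bool → Bool → Bool
  true ∧' b  = b
  false ∧' _ = false

bottom : List ℕ → ℕ
bottom c = fromMaybe 0 (lastM c)

bold : Array → List ℕ
bold T = map (λ c → suc (bottom c)) T

inB : List ℕ → ℕ → Bool
inB B z = any (λ b → b ≡ᵇ z) B

-- max{ z < y : z ∉ B } over positive integers z (0 if there is none)
maxBelow : List ℕ → ℕ → ℕ
maxBelow B zero          = 0
maxBelow B (suc zero)    = 0
maxBelow B (suc (suc z)) = if inB B (suc z) then maxBelow B (suc z) else suc z

-- value of f at x if x is an entry of column c (with bottom entry b)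
colWalk : List ℕ → ℕ → List ℕ → ℕ → Maybe ℕ
colWalk B b []      x = nothing
colWalk B b (t ∷ c) x = if x ≡ᵇ t then just (suc b) else go t c
  where
  -- y = entry directly above the current one
  go : ℕ → List ℕ → Maybe ℕ
  go y []      = nothing
  go y (u ∷ r) = if x ≡ᵇ u
                 then just (if inB B y then maxBelow B y else y)
                 else go u r

arrWalk : List ℕ → Array → ℕ → Maybe ℕ
arrWalk B []       x = nothing
arrWalk B (c ∷ cs) x with colWalk B (bottom c) c x
... | just v  = just v
... | nothing = arrWalk B cs x

-- the walk function f of T, for N = number of entries of T;
-- f(N+1) = max{ z ≤ N : z ∉ B }; arguments outside {1,…,N+1} that are
-- not entries of T are sent to 0 (irrelevant junk value).
walk : Array → ℕ → ℕ → ℕ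
walk T N x = if x ≡ᵇ suc N then maxBelow (bold T) (suc N)
             else fromMaybe 0 (arrWalk (bold T) T x)

OutInDegreeOne : ℕ → (ℕ → ℕ) → Set
OutInDegreeOne M f =
  ((x : ℕ) → 1 ≤ x → x ≤ M → (1 ≤ f x × f x ≤ M)) ×
  ((y : ℕ) → 1 ≤ y → y ≤ M →
     Σ ℕ λ x → (1 ≤ x × x ≤ M × f x ≡ y) ×
       ((x' : ℕ) → 1 ≤ x' → x' ≤ M → f x' ≡ y → x' ≡ x))

-- Reading the step word, an S needs an empty column, and there are only n
-- letters S; a W needs an active entry, i.e. fewer than (k+1)·b entries when b columns
-- are started, and this is exactly the condition that the lattice point reached by the
-- corresponding east step lies weakly above the diagonal.  So the filling never gets
-- stuck, and since every new number exceeds the earlier ones it produces n increasing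
-- columns of height k+1 containing each of 1, …, N once.
--
-- Walk.  f sends the top of a column to one more than its bottom entry, a bold number,
-- and every other x to max{z ≤ y : z ∉ B}, where y is the entry just above x (y = N for
-- x = N+1).  Tops have distinct images because distinct columns have distinct bottoms.
-- If y has an entry below it then y+1 is not bold, so max{z ≤ y : z ∉ B} is smaller than
-- max{z ≤ y' : z ∉ B} for every y' > y; as y determines x, the other images are distinct
-- too.  An injective self-map of {1, …, N+1} is a bijection.

module Submission where

open import Defs
open import Data.Bool using (true; false; if_then_else_; T)
open import Data.Bool.Properties using (¬-not; T-≡)
open import Data.Empty using (⊥; ⊥-elim)
open import Data.List using (List; []; _∷_; _++_; length; map; last; take; drop; replicate)
open import Data.List.Membership.Propositional using (_∈_)
open import Data.List.Membership.Propositional.Properties using (∈-map⁻; ∈-map⁺)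
open import Data.List.Properties
  using (length-++; length-take; length-map; length-replicate)
open import Data.List.Relation.Unary.All as All using (All; []; _∷_)
open import Data.List.Relation.Unary.All.Properties using (replicate⁺; all⁻)
open import Data.List.Relation.Unary.Any using (here; there)
open import Data.List.Relation.Unary.Linked using (Linked; []; [-]; _∷_)
import Data.List.Relation.Unary.Linked.Properties as Linked
open import Data.Maybe using (just; nothing)
open import Data.Maybe.Properties using (just-injective)
open import Data.Maybe.Relation.Binary.Connected using (Connected; just; nothing-just)
open import Data.Nat
  using (ℕ; zero; suc; _+_; _*_; _∸_; _≤_; _<_; _≡ᵇ_; _<ᵇ_; z≤n; s≤s; s≤s⁻¹; s<s⁻¹;
         _≟_; _≤?_)
open import Data.Nat.ListAction using (sum)
open import Data.Nat.Properties
open import Algebra.Properties.CommutativeSemigroup +-commutativeSemigroup using (x∙yz≈y∙xz; xy∙z≈y∙xz)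
open import Data.Product using (Σ; ∃; _×_; _,_; proj₁; proj₂)
open import Data.Sum using (_⊎_; inj₁; inj₂)
open import Data.Unit using (⊤; tt)
open import Function.Bundles using (Equivalence)
open import Relation.Binary.Definitions using (tri<; tri≈; tri>)
open import Relation.Binary.PropositionalEquality
  using (_≡_; _≢_; refl; sym; trans; cong; cong₂; subst; subst₂)
open import Relation.Nullary using (yes; no)

≡ᵇ-refl : ∀ x → (x ≡ᵇ x) ≡ true
≡ᵇ-refl zero    = refl
≡ᵇ-refl (suc x) = ≡ᵇ-refl x

≡ᵇ-true⇒≡ : ∀ x y → (x ≡ᵇ y) ≡ true → x ≡ y
≡ᵇ-true⇒≡ x y e = ≡ᵇ⇒≡ x y (subst T (sym e) tt)

≡ᵇ-false⇒≢ : ∀ x y → (x ≡ᵇ y) ≡ false → x ≢ y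
≡ᵇ-false⇒≢ x .x e refl with () ← trans (sym (≡ᵇ-refl x)) e

≢⇒≡ᵇ-false : ∀ x y → x ≢ y → (x ≡ᵇ y) ≡ false
≢⇒≡ᵇ-false x y x≢y = ¬-not λ e → x≢y (≡ᵇ-true⇒≡ x y e)

<ᵇ-true⇒< : ∀ x y → (x <ᵇ y) ≡ true → x < y
<ᵇ-true⇒< x y e = <ᵇ⇒< x y (subst T (sym e) tt)

<ᵇ-false⇒≥ : ∀ x y → (x <ᵇ y) ≡ false → y ≤ x
<ᵇ-false⇒≥ x y e = ≮⇒≥ λ x<y → subst T e (<⇒<ᵇ x<y)

-- Occurrence counting

δ : ℕ → ℕ → ℕ
δ x y = if x ≡ᵇ y then 1 else 0

δ-refl : ∀ x → δ x x ≡ 1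
δ-refl x rewrite ≡ᵇ-refl x = refl

δ-≢ : ∀ {x y} → x ≢ y → δ x y ≡ 0
δ-≢ {x} {y} x≢y rewrite ≢⇒≡ᵇ-false x y x≢y = refl

occ : ℕ → List ℕ → ℕ
occ x []       = 0
occ x (y ∷ ys) = δ x y + occ x ys

occs : ℕ → Array → ℕ
occs x []       = 0
occs x (c ∷ cs) = occ x c + occs x cs

occ-++ : ∀ x c d → occ x (c ++ d) ≡ occ x c + occ x d
occ-++ x []      d = refl
occ-++ x (y ∷ c) d rewrite occ-++ x c d = sym (+-assoc (δ x y) (occ x c) (occ x d))

∈⇒occ-pos : ∀ {x c} → x ∈ c → 1 ≤ occ x c
∈⇒occ-pos {x} (here refl) rewrite δ-refl x = s≤s z≤n
∈⇒occ-pos {x} {y ∷ _} (there x∈c) = m≤n⇒m≤o+n (δ x y) (∈⇒occ-pos x∈c)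

occ-pos⇒∈ : ∀ x c → 1 ≤ occ x c → x ∈ c
occ-pos⇒∈ x (y ∷ c) pos with x ≡ᵇ y in e
... | true  = here (≡ᵇ-true⇒≡ x y e)
... | false = there (occ-pos⇒∈ x c pos)

occ≤occs : ∀ {x c T} → c ∈ T → occ x c ≤ occs x T
occ≤occs {x} {c} {_ ∷ cs} (here refl) = m≤m+n (occ x c) (occs x cs)
occ≤occs {x} {_} {c ∷ _} (there c∈T)  = m≤n⇒m≤o+n (occ x c) (occ≤occs c∈T)

∈∈⇒occs-pos : ∀ {x c T} → c ∈ T → x ∈ c → 1 ≤ occs x T
∈∈⇒occs-pos c∈T x∈c = ≤-trans (∈⇒occ-pos x∈c) (occ≤occs c∈T)

occs-pos⇒∈∈ : ∀ x T → 1 ≤ occs x T → ∃ λ c → c ∈ T × x ∈ c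
occs-pos⇒∈∈ x (c ∷ cs) pos with occ x c in e
... | zero  = let c' , c'∈cs , x∈c' = occs-pos⇒∈∈ x cs pos in c' , there c'∈cs , x∈c'
... | suc _ = c , here refl , occ-pos⇒∈ x c (subst (1 ≤_) (sym e) (s≤s z≤n))

occs-tail-zero : ∀ {x c cs} → x ∈ c → occs x (c ∷ cs) ≤ 1 → occs x cs ≡ 0
occs-tail-zero {x} {c} {cs} x∈c once =
  n≤0⇒n≡0 (+-cancelˡ-≤ 1 (occs x cs) 0 (≤-trans (+-monoˡ-≤ (occs x cs) (∈⇒occ-pos x∈c)) once))

column-unique : ∀ {x c c' T} → occs x T ≤ 1 → c ∈ T → c' ∈ T → x ∈ c → x ∈ c' → c ≡ c'
column-unique once (here refl) (here refl) _ _ = refl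
column-unique once (here refl) (there c'∈T) x∈c x∈c' =
  ⊥-elim (<-irrefl refl (≤-trans (+-mono-≤ (∈⇒occ-pos x∈c) (∈∈⇒occs-pos c'∈T x∈c')) once))
column-unique once (there c∈T) (here refl) x∈c x∈c' =
  ⊥-elim (<-irrefl refl (≤-trans (+-mono-≤ (∈⇒occ-pos x∈c') (∈∈⇒occs-pos c∈T x∈c)) once))
column-unique {x} {T = d ∷ _} once (there c∈T) (there c'∈T) x∈c x∈c' =
  column-unique (m+n≤o⇒n≤o (occ x d) once) c∈T c'∈T x∈c x∈c'

lastM-∈ : ∀ {x} c → lastM c ≡ just x → x ∈ c
lastM-∈ (y ∷ [])    refl = here refl
lastM-∈ (y ∷ z ∷ c) e    = there (lastM-∈ (z ∷ c) e)

lastM-bottom : ∀ t r → lastM (t ∷ r) ≡ just (bottom (t ∷ r))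
lastM-bottom t []      = refl
lastM-bottom t (u ∷ r) = lastM-bottom u r

bottom-∈ : ∀ t r → bottom (t ∷ r) ∈ t ∷ r
bottom-∈ t r = lastM-∈ (t ∷ r) (lastM-bottom t r)

connected-last : ∀ {i} c → All (_< i) c → Connected _<_ (last c) (just i)
connected-last []          []             = nothing-just
connected-last (x ∷ [])    (x<i ∷ [])     = just x<i
connected-last (x ∷ y ∷ c) (_ ∷ y<i ∷ c<i) = connected-last (y ∷ c) (y<i ∷ c<i)

data Above (y x : ℕ) : List ℕ → Set where
  adj  : ∀ {r} → Above y x (y ∷ x ∷ r)
  skip : ∀ {z c} → Above y x c → Above y x (z ∷ c)

Above-∈ˡ : ∀ {y x c} → Above y x c → y ∈ c
Above-∈ˡ adj      = here refl
Above-∈ˡ (skip a) = there (Above-∈ˡ a)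

Above-∈ʳ : ∀ {y x c} → Above y x c → x ∈ c
Above-∈ʳ adj      = there (here refl)
Above-∈ʳ (skip a) = there (Above-∈ʳ a)

Above-< : ∀ {y x c} → Linked _<_ c → Above y x c → y < x
Above-< (y<x ∷ _)  adj      = y<x
Above-< (_ ∷ incr) (skip a) = Above-< incr a

Above-lastM : ∀ {y x c} → Above y x c → lastM c ≡ just y → 2 ≤ occ y c
Above-lastM {y} {x} (adj {r}) e rewrite δ-refl y = s≤s (∈⇒occ-pos (lastM-∈ (x ∷ r) e))
Above-lastM {y} {c = z ∷ _ ∷ _} (skip a) e = m≤n⇒m≤o+n (δ y z) (Above-lastM a e)

Above-unique : ∀ {y x x' c} → occ y c ≤ 1 → Above y x c → Above y x' c → x ≡ x'
Above-unique once adj adj = refl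
Above-unique {y} once adj (skip a) rewrite δ-refl y =
  ⊥-elim (<-irrefl refl (≤-trans (s≤s (∈⇒occ-pos (Above-∈ˡ a))) once))
Above-unique {y} once (skip a) adj rewrite δ-refl y =
  ⊥-elim (<-irrefl refl (≤-trans (s≤s (∈⇒occ-pos (Above-∈ˡ a))) once))
Above-unique {y} {c = z ∷ _} once (skip a) (skip a') =
  Above-unique (m+n≤o⇒n≤o (δ y z) once) a a'

-- The filling algorithm

data Appends (c : List ℕ) (i : ℕ) : Array → Array → Set where
  here  : ∀ {cs} → Appends c i (c ∷ cs) ((c ++ i ∷ []) ∷ cs)
  there : ∀ {d cs cs'} → Appends c i cs cs' → Appends c i (d ∷ cs) (d ∷ cs')

module _ {c : List ℕ} {i : ℕ} where

  Appends-∈ : ∀ {T T'} → Appends c i T T' → c ∈ T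
  Appends-∈ here      = here refl
  Appends-∈ (there a) = there (Appends-∈ a)

  Appends-length : ∀ {T T'} → Appends c i T T' → length T' ≡ length T
  Appends-length here      = refl
  Appends-length (there a) = cong suc (Appends-length a)

  Appends-size : ∀ {T T'} → Appends c i T T' → sum (map length T') ≡ suc (sum (map length T))
  Appends-size {_ ∷ cs} here
    rewrite length-++ c {i ∷ []} | +-comm (length c) 1 = refl
  Appends-size {d ∷ _} (there a) rewrite Appends-size a = +-suc (length d) _

  Appends-occs : ∀ {T T'} x → Appends c i T T' → occs x T' ≡ δ x i + occs x T
  Appends-occs {_ ∷ cs} x here rewrite occ-++ x c (i ∷ []) | +-identityʳ (δ x i) =
    xy∙z≈y∙xz (occ x c) (δ x i) (occs x cs)
  Appends-occs {d ∷ cs} x (there a) rewrite Appends-occs x a = x∙yz≈y∙xz (occ x d) (δ x i) (occs x cs)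

  Appends-All : ∀ {P : List ℕ → Set} {T T'} → Appends c i T T' →
                P (c ++ i ∷ []) → All P T → All P T'
  Appends-All here      p (_ ∷ ps) = p ∷ ps
  Appends-All (there a) p (q ∷ ps) = q ∷ Appends-All a p ps

countNonEmpty : Array → ℕ
countNonEmpty []             = 0
countNonEmpty ([] ∷ cs)      = countNonEmpty cs
countNonEmpty ((_ ∷ _) ∷ cs) = suc (countNonEmpty cs)

Appends-start : ∀ {i T T'} → Appends [] i T T' → countNonEmpty T' ≡ suc (countNonEmpty T)
Appends-start here                          = refl
Appends-start {T = [] ∷ _}      (there a) = Appends-start a
Appends-start {T = (_ ∷ _) ∷ _} (there a) = cong suc (Appends-start a)

Appends-continue : ∀ {t r i T T'} → Appends (t ∷ r) i T T' → countNonEmpty T' ≡ countNonEmpty T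
Appends-continue here                          = refl
Appends-continue {T = [] ∷ _}      (there a) = Appends-continue a
Appends-continue {T = (_ ∷ _) ∷ _} (there a) = cong suc (Appends-continue a)

record Standard (s : ℕ) (T : Array) : Set where
  field
    increasing : All (Linked _<_) T
    once       : ∀ x → 1 ≤ x → x ≤ s → occs x T ≡ 1
    absent     : ∀ x → (x ≡ 0 ⊎ s < x) → occs x T ≡ 0

  occs≤1 : ∀ x → occs x T ≤ 1
  occs≤1 zero rewrite absent zero (inj₁ refl) = z≤n
  occs≤1 (suc x) with suc x ≤? s
  ... | yes x<s rewrite once (suc x) (s≤s z≤n) x<s = ≤-refl
  ... | no  x≮s rewrite absent (suc x) (inj₂ (≰⇒> x≮s)) = z≤n

  occs-pos⇒range : ∀ x → 1 ≤ occs x T → 1 ≤ x × x ≤ s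
  occs-pos⇒range x pos with x ≤? s
  occs-pos⇒range zero    pos | _ rewrite absent zero (inj₁ refl) with () ← pos
  occs-pos⇒range (suc x) pos | yes x≤s = s≤s z≤n , x≤s
  occs-pos⇒range (suc x) pos | no  x≰s rewrite absent (suc x) (inj₂ (≰⇒> x≰s)) with () ← pos

  entry-range : ∀ {x c} → c ∈ T → x ∈ c → 1 ≤ x × x ≤ s
  entry-range c∈T x∈c = occs-pos⇒range _ (∈∈⇒occs-pos c∈T x∈c)

Standard-append : ∀ {s c T T'} → Standard s T → Appends c (suc s) T T' → Standard (suc s) T'
Standard-append {s} {c} {T} {T'} std a = record
  { increasing = Appends-All a
      (Linked.++⁺ (All.lookup increasing (Appends-∈ a)) (connected-last c (All.tabulate entry<)) [-])
      increasing
  ; once = once'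
  ; absent = absent' }
  where
  open Standard std
  entry< : ∀ {x} → x ∈ c → x < suc s
  entry< x∈c = s≤s (proj₂ (entry-range (Appends-∈ a) x∈c))
  once' : ∀ x → 1 ≤ x → x ≤ suc s → occs x T' ≡ 1
  once' x 1≤x x≤1+s rewrite Appends-occs x a with m≤n⇒m<n∨m≡n x≤1+s
  ... | inj₂ refl rewrite δ-refl (suc s) | absent (suc s) (inj₂ ≤-refl) = refl
  ... | inj₁ (s≤s x≤s) rewrite δ-≢ {x} {suc s} (<⇒≢ (s≤s x≤s)) = once x 1≤x x≤s
  absent' : ∀ x → (x ≡ 0 ⊎ suc s < x) → occs x T' ≡ 0
  absent' x (inj₁ refl) rewrite Appends-occs 0 a = absent 0 (inj₁ refl)
  absent' x (inj₂ s<x) rewrite Appends-occs x a | δ-≢ {x} {suc s} (>⇒≢ s<x) =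
    absent x (inj₂ (<-trans ≤-refl s<x))

lastM-nothing : ∀ c → lastM c ≡ nothing → c ≡ []
lastM-nothing []          _ = refl
lastM-nothing (_ ∷ [])    ()
lastM-nothing (_ ∷ _ ∷ c) e with () ← lastM-nothing (_ ∷ c) e

data ActiveView (k : ℕ) (c : List ℕ) : List ℕ → Set where
  none   : c ≡ [] ⊎ suc k ≤ length c → ActiveView k c []
  active : ∀ {x} → lastM c ≡ just x → length c < suc k → ActiveView k c (x ∷ [])

activeView : ∀ k c → ActiveView k c (activeOf k c)
activeView k c with length c <ᵇ suc k in short | lastM c in l
... | true  | just x  = active l (<ᵇ-true⇒< _ _ short)
... | true  | nothing = none (inj₁ (lastM-nothing c l))
... | false | _       = none (inj₂ (<ᵇ-false⇒≥ _ _ short))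

actives-empty⇒full : ∀ k T → All (λ c → length c ≤ suc k) T → actives k T ≡ [] →
                     sum (map length T) ≡ countNonEmpty T * suc k
actives-empty⇒full k []       []         _ = refl
actives-empty⇒full k (c ∷ cs) (c≤ ∷ cs≤) e with activeOf k c | activeView k c
... | .[] | none (inj₁ refl) = actives-empty⇒full k cs cs≤ e
... | .[] | none (inj₂ k<c) with c
...   | _ ∷ _ = cong₂ _+_ (≤-antisym c≤ k<c) (actives-empty⇒full k cs cs≤ e)

putTop-appends : ∀ i T → countNonEmpty T < length T →
                 ∃ λ T' → putTop i T ≡ just T' × Appends [] i T T'
putTop-appends i ([] ∷ cs)      _        = _ , refl , here
putTop-appends i ((x ∷ c) ∷ cs) (s≤s lt) with putTop-appends i cs lt
... | T' , eq , a rewrite eq = _ , refl , there a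

putBelow-id : ∀ k v i T → occs v T ≡ 0 → putBelow k v i T ≡ T
putBelow-id k v i []       _    = refl
putBelow-id k v i (c ∷ cs) absent with activeOf k c | activeView k c
... | .[]       | none _         = cong (c ∷_) (putBelow-id k v i cs (m+n≡0⇒n≡0 (occ v c) absent))
... | .(x ∷ []) | active {x} l _ with x ≡ᵇ v in x≡ᵇv
...   | false = cong (c ∷_) (putBelow-id k v i cs (m+n≡0⇒n≡0 (occ v c) absent))
...   | true rewrite ≡ᵇ-true⇒≡ x v x≡ᵇv
  with () ← subst (1 ≤_) (m+n≡0⇒m≡0 (occ v c) absent) (∈⇒occ-pos (lastM-∈ c l))

putBelow-appends : ∀ k v i T → v ∈ actives k T → occs v T ≤ 1 →
  ∃ λ c → lastM c ≡ just v × length c < suc k × Appends c i T (putBelow k v i T)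
putBelow-appends k v i (c ∷ cs) v∈ once with activeOf k c | activeView k c
... | .[] | none _ =
  let d , l , short , a = putBelow-appends k v i cs v∈ (m+n≤o⇒n≤o (occ v c) once)
  in d , l , short , there a
... | .(x ∷ []) | active {x} l short with x ≡ᵇ v in x≡ᵇv | v∈
...   | true  | _ rewrite ≡ᵇ-true⇒≡ x v x≡ᵇv
                        | putBelow-id k v i cs (occs-tail-zero {cs = cs} (lastM-∈ c l) once) =
  c , l , short , here
...   | false | here refl with () ← trans (sym (≡ᵇ-refl x)) x≡ᵇv
...   | false | there v∈cs =
  let d , l' , short' , a = putBelow-appends k v i cs v∈cs (m+n≤o⇒n≤o (occ v c) once)
  in d , l' , short' , there a

minM-∈ : ∀ xs {v} → minM xs ≡ just v → v ∈ xs
minM-∈ (x ∷ xs) e with minM xs in e'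
... | nothing with refl ← e = here refl
... | just y with x <ᵇ y
...   | true  with refl ← e = here refl
...   | false with refl ← e = there (minM-∈ xs e')

minM-just : ∀ x xs → ∃ λ v → minM (x ∷ xs) ≡ just v
minM-just x xs with minM xs
... | nothing = x , refl
... | just y  = _ , refl

record FillState (k n b s : ℕ) (T : Array) : Set where
  field
    standard : Standard s T
    columns  : length T ≡ n
    short    : All (λ c → length c ≤ suc k) T
    size     : sum (map length T) ≡ s
    started  : countNonEmpty T ≡ b

FillState-append : ∀ {k n b b' s c T T'} → FillState k n b s T → Appends c (suc s) T T' →
                   length c < suc k → countNonEmpty T' ≡ b' → FillState k n b' (suc s) T'
FillState-append {c = c} {T' = T'} st a c<k started' = record
  { standard = Standard-append standard a
  ; columns  = trans (Appends-length a) columns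
  ; short    = Appends-All a (subst (_≤ _) (sym (trans (length-++ c) (+-comm (length c) 1))) c<k) short
  ; size     = trans (Appends-size a) (cong suc size)
  ; started  = started' }
  where open FillState st

module _ {k n b s T} (st : FillState k n b s T) where
  open FillState st

  fillStep-S : b < n → ∃ λ T' → fillStep k (suc s) S T ≡ just T' × FillState k n (suc b) (suc s) T'
  fillStep-S b<n =
    let T' , eq , a = putTop-appends (suc s) T (subst₂ _<_ (sym started) (sym columns) b<n)
    in T' , eq , FillState-append st a (s≤s z≤n) (trans (Appends-start a) (cong suc started))

  minimal-active : s < b * suc k → ∃ λ v → minM (actives k T) ≡ just v × v ∈ actives k T
  minimal-active s<full with actives k T in eq
  ... | [] = ⊥-elim (<-irrefl (trans (sym size) (trans (actives-empty⇒full k T short eq)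
                                                      (cong (_* suc k) started))) s<full)
  ... | x ∷ xs = let v , min≡v = minM-just x xs in v , min≡v , minM-∈ (x ∷ xs) min≡v

  fillStep-W : s < b * suc k → ∃ λ T' → fillStep k (suc s) W T ≡ just T' × FillState k n b (suc s) T'
  fillStep-W s<full with minimal-active s<full
  ... | v , min≡v , v∈ rewrite min≡v
    with putBelow-appends k v (suc s) T v∈ (Standard.occs≤1 standard v)
  ...   | t ∷ r , _ , c<k , a = _ , refl , FillState-append st a c<k (trans (Appends-continue a) started)

-- Lattice paths give legal step words

-- Legal k n b s w: w can be read starting from a state with b started columns and s entries.
Legal : ℕ → ℕ → ℕ → ℕ → List Letter → Set
Legal k n b s []      = ⊤
Legal k n b s (S ∷ w) = b < n × Legal k n (suc b) (suc s) w
Legal k n b s (W ∷ w) = s < b * suc k × Legal k n b (suc s) w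

run : ∀ {k n b s T} w → FillState k n b s T → Legal k n b s w →
  ∃ λ T' → fillLoop k (suc s) w T ≡ just T' × ∃ λ b' → FillState k n b' (length w + s) T'
run []      st _ = _ , refl , _ , st
run {k} {n} {s = s} (S ∷ w) st (b<n , legal) with fillStep-S st b<n
... | _ , step , st₁ rewrite step =
  let T' , loop , b' , st' = run w st₁ legal
  in T' , loop , b' , subst (λ s' → FillState k n b' s' T') (+-suc (length w) s) st'
run {k} {n} {s = s} (W ∷ w) st (s<full , legal) with fillStep-W st s<full
... | _ , step , st₁ rewrite step =
  let T' , loop , b' , st' = run w st₁ legal
  in T' , loop , b' , subst (λ s' → FillState k n b' s' T') (+-suc (length w) s) st'

NOf≡k*n+n : ∀ k n → NOf k n ≡ k * n + n
NOf≡k*n+n k n = cong (_∸ 1) (trans (+-assoc (k * n) 1 n) (+-suc (k * n) n))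

NOf≡n*[1+k] : ∀ k n → NOf k n ≡ n * suc k
NOf≡n*[1+k] k n = trans (NOf≡k*n+n k n)
  (trans (+-comm (k * n) n) (trans (cong (n +_) (*-comm k n)) (sym (*-suc n k))))

-- The hypothesis is the path condition at the lattice point (a+1, b) reached by an east step.
east-step-fits : ∀ k n a b → suc a * n ≤ b * mOf k n → b ≤ n → suc a + b ≤ NOf k n →
                 a + b < b * suc k
east-step-fits k n a b below b≤n fits =
  subst (a + b <_) (trans (+-comm (b * k) b) (sym (*-suc b k))) (+-monoˡ-< b a<bk)
  where
  open ≤-Reasoning
  a<bk : a < b * k
  a<bk with m≤n⇒m<n∨m≡n b≤n
  ... | inj₂ refl = subst (suc a ≤_) (*-comm k b)
                      (+-cancelʳ-≤ b (suc a) (k * b) (subst (suc a + b ≤_) (NOf≡k*n+n k b) fits))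
  ... | inj₁ b<n = s<s⁻¹ (*-cancelʳ-< n (suc a) (suc (b * k)) (begin-strict
    suc a * n       ≤⟨ below ⟩
    b * mOf k n     ≡⟨ distrib b (k * n) ⟩
    b * (k * n) + b <⟨ +-monoʳ-< (b * (k * n)) b<n ⟩
    b * (k * n) + n ≡⟨ +-comm (b * (k * n)) n ⟩
    n + b * (k * n) ≡⟨ cong (n +_) (sym (*-assoc b k n)) ⟩
    suc (b * k) * n ∎))
    where
    distrib : ∀ b x → b * (x + 1) ≡ b * x + b
    distrib b x = trans (*-distribˡ-+ b x 1) (cong (b * x +_) (*-identityʳ b))

legal : ∀ k n L D a b →
  (∀ j → (a + countEast (take j D)) * n ≤ (b + countNorth (take j D)) * mOf k n) →
  b + countNorth D ≤ n → a + b + L ≤ NOf k n → Legal k n b (a + b) (take L (SW D))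
legal k n zero    D           a b _     _  _    = tt
legal k n (suc L) []          a b _     _  _    = tt
legal k n (suc L) (north ∷ D) a b above ≤n fits =
  <-≤-trans (m<m+n b (s≤s z≤n)) ≤n ,
  subst (λ s → Legal k n (suc b) s (take L (SW D))) (+-suc a b)
    (legal k n L D a (suc b)
      (λ j → subst (λ t → (a + countEast (take j D)) * n ≤ t * mOf k n) (+-suc b _) (above (suc j)))
      (subst (_≤ n) (+-suc b _) ≤n)
      (subst (_≤ NOf k n) (trans (+-suc (a + b) L) (cong (_+ L) (sym (+-suc a b)))) fits))
legal k n (suc L) (east ∷ D) a b above ≤n fits =
  east-step-fits k n a b first (m+n≤o⇒m≤o b ≤n) (≤-trans (m≤m+n (suc (a + b)) L) fits') ,
  legal k n L D (suc a) b
    (λ j → subst (λ t → t * n ≤ (b + countNorth (take j D)) * mOf k n) (+-suc a _) (above (suc j)))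
    ≤n fits'
  where
  first : suc a * n ≤ b * mOf k n
  first = subst₂ (λ x y → x * n ≤ y * mOf k n) (+-comm a 1) (+-identityʳ b) (above 1)
  fits' : suc a + b + L ≤ NOf k n
  fits' = subst (_≤ NOf k n) (+-suc (a + b) L) fits

FillState-empty : ∀ k n → FillState k n 0 0 (replicate n [])
FillState-empty k n = record
  { standard = record
    { increasing = replicate⁺ n []
    ; once       = λ { _ (s≤s _) () }
    ; absent     = λ x _ → no-occs x n }
  ; columns = length-replicate n
  ; short   = replicate⁺ n z≤n
  ; size    = no-size n
  ; started = no-started n }
  where
  no-occs : ∀ x n → occs x (replicate n []) ≡ 0
  no-occs x zero    = refl
  no-occs x (suc n) = no-occs x n
  no-size : ∀ n → sum (map length (replicate {A = List ℕ} n [])) ≡ 0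
  no-size zero    = refl
  no-size (suc n) = no-size n
  no-started : ∀ n → countNonEmpty (replicate n []) ≡ 0
  no-started zero    = refl
  no-started (suc n) = no-started n

length-steps : ∀ D → length D ≡ countEast D + countNorth D
length-steps []          = refl
length-steps (north ∷ D) = trans (cong suc (length-steps D)) (sym (+-suc _ _))
length-steps (east ∷ D)  = cong suc (length-steps D)

columns-full : ∀ K (T : Array) → All (λ c → length c ≤ K) T → sum (map length T) ≡ length T * K →
               All (λ c → length c ≡ K) T
columns-full K []       []         _ = []
columns-full K (c ∷ cs) (c≤ ∷ cs≤) e with m≤n⇒m<n∨m≡n c≤
... | inj₂ c≡ = c≡ ∷ columns-full K cs cs≤ (+-cancelˡ-≡ K _ _ (trans (cong (_+ _) (sym c≡)) e))
... | inj₁ c< = ⊥-elim (<-irrefl e (+-mono-<-≤ c< (sum≤ cs cs≤)))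
  where
  sum≤ : ∀ (T : Array) → All (λ c → length c ≤ K) T → sum (map length T) ≤ length T * K
  sum≤ []       []         = z≤n
  sum≤ (c ∷ cs) (c≤ ∷ cs≤) = +-mono-≤ c≤ (sum≤ cs cs≤)

fillLoop-first : ∀ {k n' T} w → 1 ≤ length w → Legal k (suc n') 0 0 w →
  fillLoop k 1 w (replicate (suc n') []) ≡ just T →
  fillLoop k 2 (drop 1 w) ((1 ∷ []) ∷ replicate n' []) ≡ just T
fillLoop-first (S ∷ w) _ _        loop = loop
fillLoop-first (W ∷ w) _ (() , _) _

fill≡ : ∀ k n' w T →
        fillLoop k 2 (drop 1 (take (NOf k (suc n')) w)) ((1 ∷ []) ∷ replicate n' []) ≡ just T →
        All (λ c → length c ≡ suc k) T → length T ≡ suc n' → fill k (suc n') w ≡ just T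
fill≡ k n' w T loop full columns
  rewrite loop
        | Equivalence.to T-≡ (all⁻ (λ c → length c ≡ᵇ suc k) (All.map (λ e → ≡⇒≡ᵇ _ _ e) full))
        | columns | ≡ᵇ-refl n' = refl

fill-succeeds : ∀ k n → 1 ≤ n → (D : List Step) → InD (mOf k n) n D →
  ∃ λ T → fill k n (SW D) ≡ just T × Standard (NOf k n) T × All (λ c → length c ≡ suc k) T
fill-succeeds k n@(suc n') _ D (east≡m , north≡n , above) = finish (run w (FillState-empty k n) legal-w)
  where
  N : ℕ
  N = NOf k n
  w : List Letter
  w = take N (SW D)
  legal-w : Legal k n 0 0 w
  legal-w = legal k n N D 0 0 above (≤-reflexive north≡n) ≤-refl
  length-w : length w ≡ N
  length-w = trans (length-take N (SW D))
    (m≤n⇒m⊓n≡m (subst (N ≤_) (sym length-SW) (m∸n≤m (mOf k n + n) 1)))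
    where
    length-SW : length (SW D) ≡ mOf k n + n
    length-SW = trans (length-map _ D) (trans (length-steps D) (cong₂ _+_ east≡m north≡n))
  1≤N : 1 ≤ N
  1≤N = subst (1 ≤_) (sym (trans (NOf≡k*n+n k n) (+-suc (k * n) n'))) (s≤s z≤n)
  finish : (∃ λ T → fillLoop k 1 w (replicate n []) ≡ just T ×
                    ∃ λ b → FillState k n b (length w + 0) T) →
           ∃ λ T → fill k n (SW D) ≡ just T × Standard N T × All (λ c → length c ≡ suc k) T
  finish (T , loop , _ , st) =
    T , fill≡ k n' (SW D) T (fillLoop-first w (subst (1 ≤_) (sym length-w) 1≤N) legal-w loop) full columns
      , subst (λ s → Standard s T) s≡N standard , full
    where
    open FillState st
    s≡N : length w + 0 ≡ N
    s≡N = trans (+-identityʳ (length w)) length-w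
    full : All (λ c → length c ≡ suc k) T
    full = columns-full (suc k) T short
      (trans size (trans s≡N (trans (NOf≡n*[1+k] k n) (cong (_* suc k) (sym columns)))))

-- Injective self-maps of {1, …, M}

MapsInto : ℕ → (ℕ → ℕ) → Set
MapsInto M f = ∀ x → 1 ≤ x → x ≤ M → 1 ≤ f x × f x ≤ M

InjectiveOn : ℕ → (ℕ → ℕ) → Set
InjectiveOn M f = ∀ {x x'} → 1 ≤ x → x ≤ M → 1 ≤ x' → x' ≤ M → f x ≡ f x' → x ≡ x'

-- On {1, …, M}, g is f followed by the transposition of f (M+1) and M+1, hence an injective
-- self-map of {1, …, M}; this drives the induction in injective⇒surjective.
module Redirect {M f} (maps : MapsInto (suc M) f) (inj : InjectiveOn (suc M) f) where

  g : ℕ → ℕ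
  g x = if f x ≡ᵇ suc M then f (suc M) else f x

  ≤M⇒f≢f[M+1] : ∀ {x} → 1 ≤ x → x ≤ M → f x ≢ f (suc M)
  ≤M⇒f≢f[M+1] 1≤x x≤M e with inj 1≤x (m≤n⇒m≤1+n x≤M) (s≤s z≤n) ≤-refl e
  ... | refl = <-irrefl refl x≤M

  ≤∧≢⇒≤pred : ∀ {z} → z ≤ suc M → z ≢ suc M → z ≤ M
  ≤∧≢⇒≤pred z≤ z≢ = s≤s⁻¹ (≤∧≢⇒< z≤ z≢)

  g-maps : MapsInto M g
  g-maps x 1≤x x≤M with f x ≡ᵇ suc M in e
  ... | true  = proj₁ (maps (suc M) (s≤s z≤n) ≤-refl)
              , ≤∧≢⇒≤pred (proj₂ (maps (suc M) (s≤s z≤n) ≤-refl))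
                  (λ e' → ≤M⇒f≢f[M+1] 1≤x x≤M (trans (≡ᵇ-true⇒≡ _ _ e) (sym e')))
  ... | false = proj₁ (maps x 1≤x (m≤n⇒m≤1+n x≤M))
              , ≤∧≢⇒≤pred (proj₂ (maps x 1≤x (m≤n⇒m≤1+n x≤M))) (≡ᵇ-false⇒≢ _ _ e)

  g-inj : InjectiveOn M g
  g-inj {x} {x'} 1≤x x≤M 1≤x' x'≤M e with f x ≡ᵇ suc M in ex | f x' ≡ᵇ suc M in ex'
  ... | true  | true  = inj 1≤x (m≤n⇒m≤1+n x≤M) 1≤x' (m≤n⇒m≤1+n x'≤M)
                            (trans (≡ᵇ-true⇒≡ _ _ ex) (sym (≡ᵇ-true⇒≡ _ _ ex')))
  ... | true  | false = ⊥-elim (≤M⇒f≢f[M+1] 1≤x' x'≤M (sym e))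
  ... | false | true  = ⊥-elim (≤M⇒f≢f[M+1] 1≤x x≤M e)
  ... | false | false = inj 1≤x (m≤n⇒m≤1+n x≤M) 1≤x' (m≤n⇒m≤1+n x'≤M) e

  g≡f : ∀ {x y} → y ≢ f (suc M) → g x ≡ y → f x ≡ y
  g≡f {x} y≢ e with f x ≡ᵇ suc M
  ... | true  = ⊥-elim (y≢ (sym e))
  ... | false = e

  g≡f[M+1] : ∀ {x} → 1 ≤ x → x ≤ M → g x ≡ f (suc M) → f x ≡ suc M
  g≡f[M+1] {x} 1≤x x≤M e with f x ≡ᵇ suc M in ex
  ... | true  = ≡ᵇ-true⇒≡ _ _ ex
  ... | false = ⊥-elim (≤M⇒f≢f[M+1] 1≤x x≤M e)

injective⇒surjective : ∀ M f → MapsInto M f → InjectiveOn M f →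
  ∀ y → 1 ≤ y → y ≤ M → ∃ λ x → 1 ≤ x × x ≤ M × f x ≡ y
injective⇒surjective zero    f _    _   y (s≤s _) ()
injective⇒surjective (suc M) f maps inj y 1≤y y≤M+1 with y ≟ f (suc M) | y ≟ suc M
... | yes refl | _       = suc M , s≤s z≤n , ≤-refl , refl
... | no y≢    | no y≢M+1 =
  let x , 1≤x , x≤M , gx≡y =
        injective⇒surjective M g g-maps g-inj y 1≤y (≤∧≢⇒≤pred y≤M+1 y≢M+1)
  in x , 1≤x , m≤n⇒m≤1+n x≤M , g≡f y≢ gx≡y
  where open Redirect maps inj
... | no y≢    | yes refl =
  let 1≤top , top≤M+1 = maps (suc M) (s≤s z≤n) ≤-refl
      x , 1≤x , x≤M , gx≡top =
        injective⇒surjective M g g-maps g-inj (f (suc M)) 1≤top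
          (≤∧≢⇒≤pred top≤M+1 (λ e → y≢ (sym e)))
  in x , 1≤x , m≤n⇒m≤1+n x≤M , g≡f[M+1] 1≤x x≤M gx≡top
  where open Redirect maps inj

injective⇒OutInDegreeOne : ∀ M f → MapsInto M f → InjectiveOn M f → OutInDegreeOne M f
injective⇒OutInDegreeOne M f maps inj = maps , λ y 1≤y y≤M →
  let x , 1≤x , x≤M , fx≡y = injective⇒surjective M f maps inj y 1≤y y≤M
  in x , (1≤x , x≤M , fx≡y) ,
     λ x' 1≤x' x'≤M fx'≡y → inj 1≤x' x'≤M 1≤x x≤M (trans fx'≡y (sym fx≡y))

-- The walk function

module _ (B : List ℕ) where

  maxBelow-≤ : ∀ y → maxBelow B (suc y) ≤ y
  maxBelow-≤ zero    = z≤n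
  maxBelow-≤ (suc y) with inB B (suc y)
  ... | true  = m≤n⇒m≤1+n (maxBelow-≤ y)
  ... | false = ≤-refl

  maxBelow-≥ : ∀ {z} y → 1 ≤ z → z ≤ y → inB B z ≡ false → z ≤ maxBelow B (suc y)
  maxBelow-≥ zero    (s≤s _) ()
  maxBelow-≥ {z} (suc y) 1≤z z≤y z∉B with inB B (suc y) in y∈B
  ... | false = z≤y
  ... | true with m≤n⇒m<n∨m≡n z≤y
  ...   | inj₁ (s≤s z≤y') = maxBelow-≥ y 1≤z z≤y' z∉B
  ...   | inj₂ refl with () ← trans (sym y∈B) z∉B

  maxBelow-∉ : inB B 0 ≡ false → ∀ y → inB B (maxBelow B (suc y)) ≡ false
  maxBelow-∉ 0∉B zero = 0∉B
  maxBelow-∉ 0∉B (suc y) with inB B (suc y) in y∈B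
  ... | true  = maxBelow-∉ 0∉B y
  ... | false = y∈B

  maxBelow-strict : ∀ {y y'} → y < y' → inB B (suc y) ≡ false → maxBelow B (suc y) < maxBelow B (suc y')
  maxBelow-strict {y} {y'} y<y' y+1∉B =
    ≤-trans (s≤s (maxBelow-≤ y)) (maxBelow-≥ y' (s≤s z≤n) y<y' y+1∉B)

  -- the left-hand side is colWalk's value below y; maxBelow B (suc y) = max{z ≤ y : z ∉ B}
  maxBelow-suc : ∀ y → (if inB B y then maxBelow B y else y) ≡ maxBelow B (suc y)
  maxBelow-suc zero with inB B 0
  ... | true  = refl
  ... | false = refl
  maxBelow-suc (suc y) = refl

  colWalk-top : ∀ b x r → colWalk B b (x ∷ r) x ≡ just (suc b)
  colWalk-top b x r rewrite ≡ᵇ-refl x = refl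

  colWalk-below : ∀ b {x t} r → x ≢ t → colWalk B b (t ∷ x ∷ r) x ≡ just (maxBelow B (suc t))
  colWalk-below b {x} {t} r x≢t rewrite ≢⇒≡ᵇ-false x t x≢t | ≡ᵇ-refl x = cong just (maxBelow-suc t)

  colWalk-skip : ∀ b {x t u} r → x ≢ t → x ≢ u →
                 colWalk B b (t ∷ u ∷ r) x ≡ colWalk B b (u ∷ r) x
  colWalk-skip b {x} {t} {u} r x≢t x≢u
    rewrite ≢⇒≡ᵇ-false x t x≢t | ≢⇒≡ᵇ-false x u x≢u = refl

  colWalk-below-sound : ∀ b t r {x v} → x ≢ t → colWalk B b (t ∷ r) x ≡ just v →
    ∃ λ y → Above y x (t ∷ r) × v ≡ maxBelow B (suc y)
  colWalk-below-sound b t []      {x} x≢t e rewrite ≢⇒≡ᵇ-false x t x≢t with () ← e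
  colWalk-below-sound b t (u ∷ r) {x} x≢t e with x ≟ u
  ... | yes refl = t , adj , just-injective (trans (sym e) (colWalk-below b r x≢t))
  ... | no x≢u =
    let y , a , ev = colWalk-below-sound b u r x≢u (trans (sym (colWalk-skip b r x≢t x≢u)) e)
    in y , skip a , ev

  colWalk-sound : ∀ b c x {v} → colWalk B b c x ≡ just v →
    (∃ λ r → c ≡ x ∷ r × v ≡ suc b) ⊎ (∃ λ y → Above y x c × v ≡ maxBelow B (suc y))
  colWalk-sound b (t ∷ r) x e with x ≟ t
  ... | yes refl = inj₁ (r , refl , just-injective (trans (sym e) (colWalk-top b x r)))
  ... | no x≢t   = inj₂ (colWalk-below-sound b t r x≢t e)

  colWalk-below-defined : ∀ b t r {x} → x ≢ t → x ∈ r → ∃ λ v → colWalk B b (t ∷ r) x ≡ just v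
  colWalk-below-defined b t (u ∷ r) {x} x≢t x∈r with x ≟ u | x∈r
  ... | yes refl | _          = _ , colWalk-below b r x≢t
  ... | no x≢u   | here x≡u   = ⊥-elim (x≢u x≡u)
  ... | no x≢u   | there x∈r' =
    let v , e = colWalk-below-defined b u r x≢u x∈r' in v , trans (colWalk-skip b r x≢t x≢u) e

  colWalk-defined : ∀ b c x → x ∈ c → ∃ λ v → colWalk B b c x ≡ just v
  colWalk-defined b (t ∷ r) x x∈c with x ≟ t | x∈c
  ... | yes refl | _         = _ , colWalk-top b x r
  ... | no x≢t   | here x≡t  = ⊥-elim (x≢t x≡t)
  ... | no x≢t   | there x∈r = colWalk-below-defined b t r x≢t x∈r

  arrWalk-sound : ∀ T x {v} → arrWalk B T x ≡ just v →
                  ∃ λ c → c ∈ T × colWalk B (bottom c) c x ≡ just v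
  arrWalk-sound (c ∷ cs) x e with colWalk B (bottom c) c x in col
  ... | just _  = c , here refl , trans col e
  ... | nothing = let c' , c'∈cs , col' = arrWalk-sound cs x e in c' , there c'∈cs , col'

  arrWalk-defined : ∀ {c} T x → c ∈ T → x ∈ c → ∃ λ v → arrWalk B T x ≡ just v
  arrWalk-defined (c' ∷ cs) x c∈T x∈c with colWalk B (bottom c') c' x in col
  ... | just v  = v , refl
  ... | nothing with c∈T
  ...   | there c∈cs = arrWalk-defined cs x c∈cs x∈c
  ...   | here refl with () ← trans (sym col) (proj₂ (colWalk-defined (bottom c') c' x x∈c))

inB⇒∈ : ∀ B z → inB B z ≡ true → z ∈ B
inB⇒∈ (b ∷ B) z e with b ≡ᵇ z in b≡z
... | true  = here (sym (≡ᵇ-true⇒≡ b z b≡z))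
... | false = there (inB⇒∈ B z e)

∈⇒inB : ∀ {B z} → z ∈ B → inB B z ≡ true
∈⇒inB {_ ∷ _} {z} (here refl) rewrite ≡ᵇ-refl z = refl
∈⇒inB {b ∷ _} {z} (there z∈B) with b ≡ᵇ z
... | true  = refl
... | false = ∈⇒inB z∈B

module Walk {N : ℕ} {T : Array}
            (std : Standard N T) (nonempty : All (λ c → c ≢ []) T) (1≤N : 1 ≤ N) where
  open Standard std

  B : List ℕ
  B = bold T

  f : ℕ → ℕ
  f = walk T N

  bottom∈column : ∀ {c} → c ∈ T → bottom c ∈ c
  bottom∈column {[]}    c∈T = ⊥-elim (All.lookup nonempty c∈T refl)
  bottom∈column {t ∷ r} _   = bottom-∈ t r

  bold⇒bottom : ∀ {z} → inB B z ≡ true → ∃ λ c → c ∈ T × z ≡ suc (bottom c)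
  bold⇒bottom e = ∈-map⁻ (λ c → suc (bottom c)) (inB⇒∈ B _ e)

  bottom-bold : ∀ {c} → c ∈ T → inB B (suc (bottom c)) ≡ true
  bottom-bold c∈T = ∈⇒inB (∈-map⁺ (λ c → suc (bottom c)) c∈T)

  bold≥2 : ∀ {z} → inB B z ≡ true → 2 ≤ z
  bold≥2 e with bold⇒bottom e
  ... | c , c∈T , refl = s≤s (proj₁ (entry-range c∈T (bottom∈column c∈T)))

  ≤1⇒not-bold : ∀ {z} → z ≤ 1 → inB B z ≡ false
  ≤1⇒not-bold z≤1 = ¬-not λ e → ≤⇒≯ z≤1 (bold≥2 e)

  above⇒not-bold : ∀ {c y x} → c ∈ T → Above y x c → inB B (suc y) ≡ false
  above⇒not-bold {[]}    _   ()
  above⇒not-bold {t ∷ r} {y} c∈T a = ¬-not λ e → is-bottom (bold⇒bottom e)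
    where
    is-bottom : (∃ λ c' → c' ∈ T × suc y ≡ suc (bottom c')) → ⊥
    is-bottom (c' , c'∈T , e) with suc-injective e
    ... | refl with column-unique (occs≤1 y) c∈T c'∈T (Above-∈ˡ a) (bottom∈column c'∈T)
    ...   | refl = <-irrefl refl
                (≤-trans (Above-lastM a (lastM-bottom t r)) (≤-trans (occ≤occs c∈T) (occs≤1 y)))

  data View (x : ℕ) : Set where
    top   : ∀ {r} → (x ∷ r) ∈ T → f x ≡ suc (bottom (x ∷ r)) → View x
    below : ∀ {c y} → c ∈ T → Above y x c → f x ≡ maxBelow B (suc y) → View x
    final : x ≡ suc N → View x

  f-entry : ∀ {x v} → x ≤ N → arrWalk B T x ≡ just v → f x ≡ v
  f-entry {x} x≤N walk≡v rewrite ≢⇒≡ᵇ-false x (suc N) (<⇒≢ (s≤s x≤N)) | walk≡v = refl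

  f-final : f (suc N) ≡ maxBelow B (suc N)
  f-final rewrite ≡ᵇ-refl N = refl

  view : ∀ x → 1 ≤ x → x ≤ suc N → View x
  view x 1≤x x≤N+1 with m≤n⇒m<n∨m≡n x≤N+1
  ... | inj₂ refl       = final refl
  ... | inj₁ (s≤s x≤N) with occs-pos⇒∈∈ x T (≤-reflexive (sym (once x 1≤x x≤N)))
  ...   | c , c∈T , x∈c with arrWalk-defined B T x c∈T x∈c
  ...     | v , walk≡v with arrWalk-sound B T x walk≡v
  ...       | c' , c'∈T , col≡v with colWalk-sound B (bottom c') c' x col≡v
  ...         | inj₁ (r , refl , v≡) = top   c'∈T (f-entry x≤N (trans walk≡v (cong just v≡)))
  ...         | inj₂ (y , a , v≡)    = below c'∈T a (f-entry x≤N (trans walk≡v (cong just v≡)))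

  above-< : ∀ {c y x} → c ∈ T → Above y x c → y < x
  above-< c∈T = Above-< (All.lookup increasing c∈T)

  maps-into : MapsInto (suc N) f
  maps-into x 1≤x x≤N+1 with view x 1≤x x≤N+1
  ... | top c∈T fx rewrite fx = s≤s z≤n , s≤s (proj₂ (entry-range c∈T (bottom∈column c∈T)))
  ... | below {y = y} c∈T a fx rewrite fx =
          maxBelow-≥ B y (s≤s z≤n) (proj₁ (entry-range c∈T (Above-∈ˡ a))) (≤1⇒not-bold ≤-refl)
        , ≤-trans (maxBelow-≤ B y) (<⇒≤ (<-≤-trans (above-< c∈T a) x≤N+1))
  ... | final refl rewrite f-final =
          maxBelow-≥ B N (s≤s z≤n) 1≤N (≤1⇒not-bold ≤-refl) , m≤n⇒m≤1+n (maxBelow-≤ B N)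

  top≢below : ∀ {c} y → c ∈ T → suc (bottom c) ≢ maxBelow B (suc y)
  top≢below y c∈T e
    with () ← trans (sym (bottom-bold c∈T)) (trans (cong (inB B) e) (maxBelow-∉ B (≤1⇒not-bold z≤n) y))

  below<final : ∀ {c y x} → c ∈ T → Above y x c → maxBelow B (suc y) < maxBelow B (suc N)
  below<final c∈T a =
    maxBelow-strict B (<-≤-trans (above-< c∈T a) (proj₂ (entry-range c∈T (Above-∈ʳ a))))
                      (above⇒not-bold c∈T a)

  top-injective : ∀ {x x' r r'} → (x ∷ r) ∈ T → (x' ∷ r') ∈ T →
                  bottom (x ∷ r) ≡ bottom (x' ∷ r') → x ≡ x'
  top-injective {x} {x'} {r} {r'} c∈T c'∈T e
    with column-unique (occs≤1 _) c∈T c'∈T (bottom-∈ x r)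
           (subst (_∈ x' ∷ r') (sym e) (bottom-∈ x' r'))
  ... | refl = refl

  below-injective : ∀ {c c' y y' x x'} → c ∈ T → c' ∈ T → Above y x c → Above y' x' c' →
                    maxBelow B (suc y) ≡ maxBelow B (suc y') → x ≡ x'
  below-injective {y = y} {y'} c∈T c'∈T a a' e with <-cmp y y'
  ... | tri< y<y' _ _ = ⊥-elim (<-irrefl e (maxBelow-strict B y<y' (above⇒not-bold c∈T a)))
  ... | tri> _ _ y>y' = ⊥-elim (<-irrefl (sym e) (maxBelow-strict B y>y' (above⇒not-bold c'∈T a')))
  ... | tri≈ _ refl _ with column-unique (occs≤1 y) c∈T c'∈T (Above-∈ˡ a) (Above-∈ˡ a')
  ...   | refl = Above-unique (≤-trans (occ≤occs c∈T) (occs≤1 y)) a a'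

  via : ∀ {x x' v v'} → f x ≡ v → f x' ≡ v' → f x ≡ f x' → v ≡ v'
  via fx fx' e = trans (sym fx) (trans e fx')

  injective : InjectiveOn (suc N) f
  injective {x} {x'} 1≤x x≤N+1 1≤x' x'≤N+1 e with view x 1≤x x≤N+1 | view x' 1≤x' x'≤N+1
  ... | top c∈T fx     | top c'∈T fx'      = top-injective c∈T c'∈T (suc-injective (via fx fx' e))
  ... | top c∈T fx     | below {y = y'} _ _ fx' = ⊥-elim (top≢below y' c∈T (via fx fx' e))
  ... | below {y = y} _ _ fx | top c'∈T fx'    = ⊥-elim (top≢below y c'∈T (via fx' fx (sym e)))
  ... | top c∈T fx     | final refl        = ⊥-elim (top≢below N c∈T (via fx f-final e))
  ... | final refl     | top c'∈T fx'      = ⊥-elim (top≢below N c'∈T (via fx' f-final (sym e)))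
  ... | below c∈T a fx | below c'∈T a' fx' = below-injective c∈T c'∈T a a' (via fx fx' e)
  ... | below c∈T a fx | final refl        = ⊥-elim (<-irrefl (via fx f-final e) (below<final c∈T a))
  ... | final refl     | below c'∈T a' fx' = ⊥-elim (<-irrefl (via fx' f-final (sym e)) (below<final c'∈T a'))
  ... | final refl     | final refl        = refl

walk-OutInDegreeOne : ∀ {N T} → Standard N T → All (λ c → c ≢ []) T → 1 ≤ N →
                      OutInDegreeOne (suc N) (walk T N)
walk-OutInDegreeOne std nonempty 1≤N = injective⇒OutInDegreeOne _ _ maps-into injective
  where open Walk std nonempty 1≤N

lemma2p5 : (k n : ℕ) → 1 ≤ k → 1 ≤ n → (D : List Step) → InD (mOf k n) n D →
    Σ Array λ T → fill k n (SW D) ≡ just T ×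
      OutInDegreeOne (suc (NOf k n)) (walk T (NOf k n))
lemma2p5 k n _ 1≤n D path =
  let T , filled , standard , full = fill-succeeds k n 1≤n D path
  in T , filled , walk-OutInDegreeOne standard (All.map (λ { len refl → 0≢1+n len }) full) 1≤N
  where
  1≤N : 1 ≤ NOf k n
  1≤N = ≤-trans 1≤n (subst (n ≤_) (sym (NOf≡k*n+n k n)) (m≤n+m n (k * n)))
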